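{- If $(u,v)$ is a Hofstadter G pair, then $(v,u+v)$ and $(v+1,u+v+1)$ are Hofstadter G pairs.
   Context: $\phi=(1+\sqrt5)/2$. Hofstadter's G function is $G(x)=\lfloor\phi^{ -1}(x+1)\rfloor$ for integers $x\ge0$ (equivalently $G(0)=0$, $G(1)=1$, $G(x)=x-G(G(x-1))$). A Hofstadter G pair is a pair $(u,v)$ of positive integers with $u=G(v)$. -}

module Defs where

open import Data.Nat using (ℕ; zero; suc; _+_; _∸_; _<_)
open import Relation.Binary.PropositionalEquality using (_≡_)

-- Hofstadter's G via its recursion G(0)=0, G(1)=1, G(x)=x-G(G(x-1)),
-- computed with a fuel argument (fuel k suffices for all x ≤ k, since G(y) ≤ y).
Gfuel : ℕ → ℕ → ℕ
Gfuel _       zero          = 0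
Gfuel _       (suc zero)    = 1
Gfuel zero    (suc (suc x)) = 0   -- unreachable when fuel ≥ argument
Gfuel (suc k) (suc (suc x)) = suc (suc x) ∸ Gfuel k (Gfuel k (suc x))

G : ℕ → ℕ
G x = Gfuel x x

record GPair (u v : ℕ) : Set where
  field
    u-pos : 0 < u
    v-pos : 0 < v
    eq    : u ≡ G v

{-# OPTIONS --safe #-}
module Submission where

open import Defs
open import Data.Nat using (ℕ; zero; suc; _+_; _∸_; _≤_; _<_; z≤n; s≤s)
open import Data.Nat.Induction using (<-rec)
open import Data.Nat.Properties
open import Data.Product using (_×_; _,_; proj₁; proj₂)
open import Data.Sum using (_⊎_; inj₁; inj₂)
open import Function using (_∘_)
open import Relation.Binary.PropositionalEquality

-- For a pair u = G v it suffices that n ↦ n + G n and n ↦ n + G n + 1 are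
-- right inverses of G.  Both are proved together by induction on n: with
-- n* = n + G n, the point (n + 1) + G (n + 1) is n* + 1 or n* + 2 according as
-- G increases by 0 or by 1 at n, and in either case the recursion
-- G (y + 2) = y + 2 − G (G (y + 1)), with G (G (y + 1)) supplied by the
-- induction hypothesis, evaluates G there.  That G increases by 0 or 1 at every
-- step follows by strong induction, because the recursion gives
-- G (x + 3) − G (x + 2) = 1 − (G (G (x + 2)) − G (G (x + 1))) and a composite of
-- functions increasing by 0 or 1 again increases by 0 or 1.

Gfuel-≤ : ∀ k x → Gfuel k x ≤ x
Gfuel-≤ _       zero          = z≤n
Gfuel-≤ _       (suc zero)    = s≤s z≤n
Gfuel-≤ zero    (suc (suc x)) = z≤n
Gfuel-≤ (suc k) (suc (suc x)) = m∸n≤m (suc (suc x)) (Gfuel k (Gfuel k (suc x)))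

Gfuel-irrelevant : ∀ k k' x → x ≤ k → x ≤ k' → Gfuel k x ≡ Gfuel k' x
Gfuel-irrelevant _       _        zero          _       _       = refl
Gfuel-irrelevant _       _        (suc zero)    _       _       = refl
Gfuel-irrelevant (suc k) (suc k') (suc (suc x)) (s≤s p) (s≤s q)
  rewrite Gfuel-irrelevant k k' (suc x) p q =
  cong (suc (suc x) ∸_) (Gfuel-irrelevant k k' y (≤-trans y≤ p) (≤-trans y≤ q))
  where
  y : ℕ
  y = Gfuel k' (suc x)
  y≤ : y ≤ suc x
  y≤ = Gfuel-≤ k' (suc x)

G-≤ : ∀ x → G x ≤ x
G-≤ x = Gfuel-≤ x x

G-rec : ∀ x → G (suc (suc x)) ≡ suc (suc x) ∸ G (G (suc x))
G-rec x = cong (suc (suc x) ∸_)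
  (Gfuel-irrelevant (suc x) (G (suc x)) (G (suc x)) (G-≤ (suc x)) ≤-refl)

G-rec-cancel : ∀ {y m k} → G (suc y) ≡ m → suc (suc y) ≡ k + G m →
               G (suc (suc y)) ≡ k
G-rec-cancel {y} {m} {k} G[1+y]≡m 2+y≡k+Gm = begin
  G (suc (suc y))               ≡⟨ G-rec y ⟩
  suc (suc y) ∸ G (G (suc y))   ≡⟨ cong (λ z → suc (suc y) ∸ G z) G[1+y]≡m ⟩
  suc (suc y) ∸ G m             ≡⟨ cong (_∸ G m) 2+y≡k+Gm ⟩
  k + G m ∸ G m                 ≡⟨ m+n∸n≡m k (G m) ⟩
  k                             ∎
  where open ≡-Reasoning

UnitStep : (ℕ → ℕ) → ℕ → Set
UnitStep f n = f (suc n) ≡ f n ⊎ f (suc n) ≡ suc (f n)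

∘-unitStep : ∀ {f g n} → UnitStep f n → UnitStep g (f n) → UnitStep (g ∘ f) n
∘-unitStep {g = g} (inj₁ f-flat) _ = inj₁ (cong g f-flat)
∘-unitStep {g = g} (inj₂ f-up) g-step rewrite f-up = g-step

G-unitStep-from-GG : ∀ x → UnitStep (G ∘ G) (suc x) → UnitStep G (suc (suc x))
G-unitStep-from-GG x (inj₁ GG-flat) = inj₂ (begin
  G (suc (suc (suc x)))                    ≡⟨ G-rec (suc x) ⟩
  suc (suc (suc x)) ∸ G (G (suc (suc x)))  ≡⟨ cong (suc (suc (suc x)) ∸_) GG-flat ⟩
  suc (suc (suc x)) ∸ G (G (suc x))        ≡⟨ +-∸-assoc 1 GG≤ ⟩
  suc (suc (suc x) ∸ G (G (suc x)))        ≡⟨ cong suc (sym (G-rec x)) ⟩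
  suc (G (suc (suc x)))                    ∎)
  where
  open ≡-Reasoning
  GG≤ : G (G (suc x)) ≤ suc (suc x)
  GG≤ = ≤-trans (G-≤ _) (≤-trans (G-≤ (suc x)) (n≤1+n _))
G-unitStep-from-GG x (inj₂ GG-up) = inj₁ (begin
  G (suc (suc (suc x)))                    ≡⟨ G-rec (suc x) ⟩
  suc (suc (suc x)) ∸ G (G (suc (suc x)))  ≡⟨ cong (suc (suc (suc x)) ∸_) GG-up ⟩
  suc (suc x) ∸ G (G (suc x))              ≡⟨ sym (G-rec x) ⟩
  G (suc (suc x))                          ∎)
  where open ≡-Reasoning

G-unitStep : ∀ n → UnitStep G n
G-unitStep = <-rec (UnitStep G) step
  where
  step : ∀ n → (∀ {m} → m < n → UnitStep G m) → UnitStep G n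
  step zero          _  = inj₂ refl
  step (suc zero)    _  = inj₁ refl
  step (suc (suc x)) ih = G-unitStep-from-GG x
    (∘-unitStep {G} {G} {suc x} (ih ≤-refl) (ih (s≤s (G-≤ (suc x)))))

G-inverts-n+Gn : ∀ n → G (n + G n) ≡ n × G (suc (n + G n)) ≡ suc n
G-inverts-n+Gn zero = refl , refl
G-inverts-n+Gn (suc p) with G-inverts-n+Gn p | G-unitStep p
... | _ , G[1+p*]≡1+p | inj₁ flat rewrite flat =
  G[1+p*]≡1+p , G-rec-cancel G[1+p*]≡1+p (cong (suc (suc p) +_) (sym flat))
... | _ , G[1+p*]≡1+p | inj₂ up =
  subst (λ z → G z ≡ suc p) 2+p*≡n* G[2+p*]≡1+p ,
  subst (λ z → G (suc z) ≡ suc (suc p)) 2+p*≡n*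
    (G-rec-cancel G[2+p*]≡1+p (cong suc 2+p*≡n*))
  where
  2+p*≡n* : suc (suc (p + G p)) ≡ suc p + G (suc p)
  2+p*≡n* = trans (cong suc (sym (+-suc p (G p)))) (cong (suc p +_) (sym up))
  G[2+p*]≡1+p : G (suc (suc (p + G p))) ≡ suc p
  G[2+p*]≡1+p = G-rec-cancel G[1+p*]≡1+p 2+p*≡n*

lemma2 : (u v : ℕ) → GPair u v → GPair v (u + v) × GPair (suc v) (suc (u + v))
lemma2 u v gp =
  record { u-pos = v-pos ; v-pos = ≤-trans v-pos (m≤n+m v u) ; eq = sym G[u+v]≡v }
  , record { u-pos = s≤s z≤n ; v-pos = s≤s z≤n ; eq = sym G[1+u+v]≡1+v }
  where
  open GPair gp using (v-pos; eq)
  u+v≡v+Gv : u + v ≡ v + G v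
  u+v≡v+Gv = trans (+-comm u v) (cong (v +_) eq)
  G[u+v]≡v : G (u + v) ≡ v
  G[u+v]≡v = trans (cong G u+v≡v+Gv) (proj₁ (G-inverts-n+Gn v))
  G[1+u+v]≡1+v : G (suc (u + v)) ≡ suc v
  G[1+u+v]≡1+v = trans (cong (G ∘ suc) u+v≡v+Gv) (proj₂ (G-inverts-n+Gn v))
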